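{- Let $D$ be a (plane) alternating dimap that is a c-cycle block of size $m\ge 1$. Then $T_c(D;x,y)=x^{m-1}$.
   Context: An alternating dimap is a directed graph (loops and multiple edges allowed) 2-cell embedded in a disjoint union of orientable closed surfaces such that around every vertex the incident edge-ends alternate between incoming and outgoing; every face is a c-face (clockwise boundary) or an a-face (anticlockwise boundary). Here alternating dimaps are plane. A block is a maximal connected alternating subdimap with no cutvertex. A c-cycle block is a block that is a clockwise face having the same number of vertices as edges (i.e. a directed cycle bounding a c-face); its size is its number of edges. For an edge $e=uv$, its right (resp. left) successor is the next edge after $e$ around the c-face (resp. a-face) containing $e$. Edge types: 1-loop (head has degree 2); $\omega$-loop (alone forms an a-face); $\omega^2$-loop (alone forms a c-face); ultraloop (all three); triloop (any of these); proper $\mu$-loop (not an ultraloop). 1-semiloop: an ordinary loop. $\omega$-semiloop: a loop that is its own right successor, or $e$ and its right successor are distinct and form a cutset or their removal decreases the genus. $\omega^2$-semiloop: an $\omega$-loop that is its own left successor, or $e$ and its left successor are distinct and form a cutset or their removal decreases the genus. Proper $\mu$-semiloop: a $\mu$-semiloop that is not a triloop. Reductions of $e=uv$: if $e$ is an $\omega$- or $\omega^2$-loop, $D[1]e=D[\omega]e=D[\omega^2]e$ deletes $e$. Otherwise $D[1]e$ contracts $e$ if $e$ is not a loop; if $e$ is a loop at $v$ with cyclic order of edge-ends $e,a_1,b_1,\dots,a_s,b_s,e,c_1,d_1,\dots,c_t,d_t$ (starting at the outgoing end of $e$), $e$ is removed and $v$ split into $v_1$ (incident with $c_i,d_i$)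 and $v_2$ (incident with $a_i,b_i$). $D[\omega]e$: with left successor $\ell=vn$, delete $e,\ell$, add new edge $un$ in their place, remove $v$ if $\deg(v)=2$. $D[\omega^2]e$: same with right successor $r=vm$, adding $um$. c-Tutte invariant ($x,y$ indeterminates): $T_c(\emptyset)=1$, multiplicative over disjoint unions, invariant under isomorphism, and for $e\in E(D)$: $T_c(D)=T_c(D\setminus e)$ if $e$ is an ultraloop; $=x\,T_c(D[\omega^2]e)$ if $e$ is a proper 1-loop or proper $\omega$-semiloop; $=y\,T_c(D[1]e)$ if a proper $\omega$-loop or proper 1-semiloop; $=T_c(D[\omega]e)$ if a proper $\omega^2$-loop or proper $\omega^2$-semiloop; $=T_c(D[1]e)+T_c(D[\omega^2]e)$ otherwise. The value $T_c(D)$ is computed by applying these rules to successive edges. -}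

module Defs where

open import Level using (Level; _⊔_) renaming (suc to lsuc)
open import Data.Nat.Base using (ℕ; zero; suc; _+_; _*_; _∸_; ⌊_/2⌋; _<ᵇ_; _<_)
open import Data.Bool.Base using (Bool; true; false; _∧_; _∨_; not; if_then_else_)
open import Data.Fin.Base using (Fin; toℕ; _↑ˡ_; _↑ʳ_; splitAt)
open import Data.Fin.Properties using (_≟_)
open import Data.Fin.Permutation using (Permutation′; _⟨$⟩ʳ_; _⟨$⟩ˡ_; _∘ₚ_; transpose; remove)
open import Data.List.Base using (List; allFin; map; upTo)
open import Data.Bool.ListAction using (any; all)
open import Data.Nat.ListAction using (sum)
open import Data.Sum.Base using (_⊎_; [_,_]′)
open import Data.Product.Base using (_×_; ∃)
open import Relation.Nullary.Decidable.Core using (⌊_⌋)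
open import Relation.Nullary.Negation.Core using (¬_)
open import Relation.Binary.PropositionalEquality.Core using (_≡_; _≢_)
open import Algebra.Bundles using (CommutativeSemiring)

iter : ∀ {N} → (Fin N → Fin N) → ℕ → Fin N → Fin N
iter f zero i = i
iter f (suc k) i = f (iter f k i)

countB : ∀ {A : Set} → (A → Bool) → List A → ℕ
countB p xs = sum (map (λ x → if p x then 1 else 0) xs)

eqB : ∀ {N} → Fin N → Fin N → Bool
eqB i j = ⌊ i ≟ j ⌋

-- j is reachable from i by iterating f (N steps suffice on Fin N)
reachB : ∀ {N} → (Fin N → Fin N) → Fin N → Fin N → Bool
reachB {N} f i j = any (λ k → eqB (iter f k i) j) (upTo (suc N))

-- number of orbits (cycles) of a permutation f of Fin N
-- (an element is a representative iff no smaller element reaches it)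
orbits : ∀ {N} → (Fin N → Fin N) → ℕ
orbits {N} f = countB (λ i → not (any (λ j → (toℕ j <ᵇ toℕ i) ∧ reachB f j i) (allFin N))) (allFin N)

reach2 : ∀ {N} → (Fin N → Fin N) → (Fin N → Fin N) → Fin N → Fin N → Bool
reach2 {N} f g i = go N (eqB i)
  where
  step : (Fin N → Bool) → Fin N → Bool
  step S j = S j ∨ any (λ x → S x ∧ (eqB (f x) j ∨ eqB (g x) j)) (allFin N)
  go : ℕ → (Fin N → Bool) → Fin N → Bool
  go zero S = S
  go (suc k) S = go k (step S)

comps : ∀ {N} → (Fin N → Fin N) → (Fin N → Fin N) → ℕ
comps {N} f g = countB (λ i → not (any (λ j → (toℕ j <ᵇ toℕ i) ∧ reach2 f g j i) (allFin N))) (allFin N)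

SameOrbit : ∀ {N} → (Fin N → Fin N) → Fin N → Fin N → Set
SameOrbit f i j = ∃ λ k → iter f k i ≡ j

-- Edges are Fin n.  r e = right successor of e (next edge around the
-- c-face containing e), l e = left successor (next edge around the
-- a-face containing e).  The in-ends around a vertex are cyclically
-- permuted by v = l⁻¹ ∘ r; the head of e is the v-orbit of e, the tail
-- of e is the v-orbit of r⁻¹ e.  Every pair of permutations (r , l) is
-- an alternating dimap (on a disjoint union of orientable surfaces).

record Dimap : Set where
  constructor dimap
  field
    n : ℕ
    r : Permutation′ n
    l : Permutation′ n

module _ (D : Dimap) where
  open Dimap D

  rs : Fin n → Fin n
  rs e = r ⟨$⟩ʳ e

  ls : Fin n → Fin n
  ls e = l ⟨$⟩ʳ e

  vs : Fin n → Fin n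
  vs e = l ⟨$⟩ˡ (r ⟨$⟩ʳ e)

  -- underlying map: darts = edge-ends, in-end of e = e ↑ˡ n, out-end = n ↑ʳ e
  dartEdge : Fin (n + n) → Fin n
  dartEdge d = [ (λ e → e) , (λ e → e) ]′ (splitAt n d)

  σ : Fin (n + n) → Fin (n + n)
  σ d = [ (λ e → n ↑ʳ (r ⟨$⟩ʳ e)) , (λ f → (l ⟨$⟩ˡ f) ↑ˡ n) ]′ (splitAt n d)

  α : Fin (n + n) → Fin (n + n)
  α d = [ (λ e → n ↑ʳ e) , (λ e → e ↑ˡ n) ]′ (splitAt n d)

  -- Embedded graph D - S obtained by deleting the edge set S (vertices kept).
  module Deleted (S : Fin n → Bool) where
    del : Fin (n + n) → Bool
    del d = S (dartEdge d)

    nextAlive : ℕ → Fin (n + n) → Fin (n + n) → Fin (n + n)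
    nextAlive zero x dflt = dflt
    nextAlive (suc k) x dflt = if del (σ x) then nextAlive k (σ x) dflt else σ x

    σS : Fin (n + n) → Fin (n + n)
    σS d = nextAlive (n + n) d d

    αS : Fin (n + n) → Fin (n + n)
    αS d = if del d then d else α d

    φS : Fin (n + n) → Fin (n + n)
    φS d = if del d then d else σS (α d)

    #S : ℕ
    #S = countB S (allFin n)

    #V : ℕ
    #V = orbits σ

    #E : ℕ
    #E = n ∸ #S

    #isolated : ℕ
    #isolated = countB (λ i → not (any (λ j → (toℕ j <ᵇ toℕ i) ∧ reachB σ j i) (allFin (n + n)))
                              ∧ all (λ j → not (reachB σ i j) ∨ del j) (allFin (n + n)))
                       (allFin (n + n))

    -- each isolated vertex bounds one face
    #F : ℕ
    #F = (orbits φS ∸ (#S + #S)) + #isolated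

    #K : ℕ
    #K = comps σ αS

    -- total genus, from  V - E + F = 2K - 2g
    genusS : ℕ
    genusS = ⌊ ((#K + #K) + #E) ∸ (#V + #F) /2⌋

  none : Fin n → Bool
  none _ = false

  pair : Fin n → Fin n → Fin n → Bool
  pair e f x = eqB x e ∨ eqB x f

  components : ℕ
  components = Deleted.#K none

  vertices : ℕ
  vertices = Deleted.#V none

  genus : ℕ
  genus = Deleted.genusS none

  Plane : Set
  Plane = genus ≡ 0

  Cutset2 : Fin n → Fin n → Set
  Cutset2 e f = components < Deleted.#K (pair e f)

  GenusDrop2 : Fin n → Fin n → Set
  GenusDrop2 e f = Deleted.genusS (pair e f) < genus

  headDeg : Fin n → ℕ
  headDeg e = 2 * countB (reachB vs e) (allFin n)

  OrdinaryLoop : Fin n → Set                    -- tail = head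
  OrdinaryLoop e = SameOrbit vs (r ⟨$⟩ˡ e) e

  OneLoop : Fin n → Set
  OneLoop e = headDeg e ≡ 2

  OmegaLoop : Fin n → Set                       -- alone forms an a-face
  OmegaLoop e = ls e ≡ e

  Omega2Loop : Fin n → Set                      -- alone forms a c-face
  Omega2Loop e = rs e ≡ e

  Ultraloop : Fin n → Set
  Ultraloop e = OneLoop e × OmegaLoop e × Omega2Loop e

  Triloop : Fin n → Set
  Triloop e = OneLoop e ⊎ OmegaLoop e ⊎ Omega2Loop e

  OneSemiloop : Fin n → Set
  OneSemiloop = OrdinaryLoop

  OmegaSemiloop : Fin n → Set
  OmegaSemiloop e = (OrdinaryLoop e × rs e ≡ e)
                  ⊎ (rs e ≢ e × (Cutset2 e (rs e) ⊎ GenusDrop2 e (rs e)))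

  Omega2Semiloop : Fin n → Set
  Omega2Semiloop e = (OrdinaryLoop e × ls e ≡ e)
                   ⊎ (ls e ≢ e × (Cutset2 e (ls e) ⊎ GenusDrop2 e (ls e)))

  ProperOneLoop ProperOmegaLoop ProperOmega2Loop : Fin n → Set
  ProperOneLoop e = OneLoop e × ¬ Ultraloop e
  ProperOmegaLoop e = OmegaLoop e × ¬ Ultraloop e
  ProperOmega2Loop e = Omega2Loop e × ¬ Ultraloop e

  ProperOneSemiloop ProperOmegaSemiloop ProperOmega2Semiloop : Fin n → Set
  ProperOneSemiloop e = OneSemiloop e × ¬ Triloop e
  ProperOmegaSemiloop e = OmegaSemiloop e × ¬ Triloop e
  ProperOmega2Semiloop e = Omega2Semiloop e × ¬ Triloop e

  -- c-cycle block of size m: all of D is the boundary of one c-face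
  -- (a single r-cycle through all edges) and #vertices = #edges = m.
  CCycleBlock : ℕ → Set
  CCycleBlock m = (n ≡ m) × ((e f : Fin n) → SameOrbit rs e f) × (vertices ≡ n)

-- remove d from the cycle structure of π (π' x = π x, or π d if π x = d),
-- then reindex Fin (suc k) ∖ {d} ≅ Fin k by punching out d.
-- (opaque only to keep Agda's positivity checker from normalising the
-- large proof terms inside remove; use  'unfolding skip'  to reason about it)
opaque
  skip : ∀ {k} → Fin (suc k) → Permutation′ (suc k) → Permutation′ k
  skip d π = remove d (transpose (π ⟨$⟩ˡ d) d ∘ₚ π)

-- deletion of e (used for ω/ω²-loops and ultraloops); also D[1]e
-- (contraction of a non-loop, vertex splitting for a loop)
red1 : ∀ {k} → Permutation′ (suc k) → Permutation′ (suc k) → Fin (suc k) → Dimap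
red1 {k} r l e = dimap k (skip e r) (skip e l)

-- replace e and s (a successor of e at its head) by one edge: the new
-- edge gets label e, s is removed.
merge : ∀ {k} → Permutation′ (suc k) → Permutation′ (suc k) → Fin (suc k) → Fin (suc k) → Dimap
merge {k} r l e s = dimap k (skip s (transpose e s ∘ₚ r)) (skip s (transpose e s ∘ₚ l))

isω∨ω²Loop : ∀ {k} → Permutation′ (suc k) → Permutation′ (suc k) → Fin (suc k) → Bool
isω∨ω²Loop {k} r l e = eqB {suc k} (l ⟨$⟩ʳ e) e ∨ eqB (r ⟨$⟩ʳ e) e

redω : ∀ {k} → Permutation′ (suc k) → Permutation′ (suc k) → Fin (suc k) → Dimap
redω {k} r l e = if isω∨ω²Loop {k} r l e then red1 {k} r l e else merge {k} r l e (l ⟨$⟩ʳ e)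

redω² : ∀ {k} → Permutation′ (suc k) → Permutation′ (suc k) → Fin (suc k) → Dimap
redω² {k} r l e = if isω∨ω²Loop {k} r l e then red1 {k} r l e else merge {k} r l e (r ⟨$⟩ʳ e)

-- c-Tutte invariant, as the relation "t is a value obtained by applying
-- the defining rules to successive edges" (rules tried in the listed
-- order), with values in an arbitrary commutative semiring and x, y.

pow : ∀ {c ℓ} (R : CommutativeSemiring c ℓ) → CommutativeSemiring.Carrier R → ℕ → CommutativeSemiring.Carrier R
pow R x zero = CommutativeSemiring.1# R
pow R x (suc k) = CommutativeSemiring._*_ R x (pow R x k)

module _ {c ℓ} (R : CommutativeSemiring c ℓ) (x y : CommutativeSemiring.Carrier R) where
  open CommutativeSemiring R using (Carrier; 1#) renaming (_+_ to _⊕_; _*_ to _⊛_)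

  data Tc : Dimap → Carrier → Set c where
    tc-empty : ∀ {r l} → Tc (dimap 0 r l) 1#
    tc-ultra : ∀ {k r l t} (e : Fin (suc k)) →
      Ultraloop (dimap (suc k) r l) e →
      Tc (red1 {k} r l e) t → Tc (dimap (suc k) r l) t
    tc-x : ∀ {k r l t} (e : Fin (suc k)) →
      ¬ Ultraloop (dimap (suc k) r l) e →
      (ProperOneLoop (dimap (suc k) r l) e ⊎ ProperOmegaSemiloop (dimap (suc k) r l) e) →
      Tc (redω² {k} r l e) t → Tc (dimap (suc k) r l) (x ⊛ t)
    tc-y : ∀ {k r l t} (e : Fin (suc k)) →
      ¬ Ultraloop (dimap (suc k) r l) e →
      ¬ (ProperOneLoop (dimap (suc k) r l) e ⊎ ProperOmegaSemiloop (dimap (suc k) r l) e) →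
      (ProperOmegaLoop (dimap (suc k) r l) e ⊎ ProperOneSemiloop (dimap (suc k) r l) e) →
      Tc (red1 {k} r l e) t → Tc (dimap (suc k) r l) (y ⊛ t)
    tc-ω : ∀ {k r l t} (e : Fin (suc k)) →
      ¬ Ultraloop (dimap (suc k) r l) e →
      ¬ (ProperOneLoop (dimap (suc k) r l) e ⊎ ProperOmegaSemiloop (dimap (suc k) r l) e) →
      ¬ (ProperOmegaLoop (dimap (suc k) r l) e ⊎ ProperOneSemiloop (dimap (suc k) r l) e) →
      (ProperOmega2Loop (dimap (suc k) r l) e ⊎ ProperOmega2Semiloop (dimap (suc k) r l) e) →
      Tc (redω {k} r l e) t → Tc (dimap (suc k) r l) t
    tc-sum : ∀ {k r l t₁ t₂} (e : Fin (suc k)) →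
      ¬ Ultraloop (dimap (suc k) r l) e →
      ¬ (ProperOneLoop (dimap (suc k) r l) e ⊎ ProperOmegaSemiloop (dimap (suc k) r l) e) →
      ¬ (ProperOmegaLoop (dimap (suc k) r l) e ⊎ ProperOneSemiloop (dimap (suc k) r l) e) →
      ¬ (ProperOmega2Loop (dimap (suc k) r l) e ⊎ ProperOmega2Semiloop (dimap (suc k) r l) e) →
      Tc (red1 {k} r l e) t₁ → Tc (redω² {k} r l e) t₂ → Tc (dimap (suc k) r l) (t₁ ⊕ t₂)

{-# OPTIONS --safe #-}
-- A vertex is a σ-orbit of edge-ends and is counted through the least dart of its orbit. An
-- out-end is never least, since the in-end of its r-predecessor (which has a smaller index)
-- reaches it in one step; so #vertices = #edges forces every in-end to be least. Hence the
-- vertex rotation l⁻¹ ∘ r, which is σ² on in-ends, never increases an index; being injective,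
-- it is the identity: r = l. Consequently every edge is a 1-loop, and an ultraloop iff m = 1.
-- For m ≥ 2 no edge is fixed by r, so the x-rule is the only rule that applies, and D[ω²]e,
-- merging e with its right successor, is again a single c-cycle with r = l, on m − 1 edges.
module Submission where

open import Defs
open import Data.Nat.Base using (ℕ; zero; suc; _+_; _*_; _≤_; _<_; _∸_; z≤n; s≤s; _<ᵇ_)
open import Data.Nat.ListAction using (sum)
open import Data.Nat.Properties using (+-assoc; m≤n⇒m≤1+n; <⇒≢; ≮⇒≥; <⇒<ᵇ; ≤-trans; m≤m+n)
import Data.Nat.Properties as ℕ
open import Data.Bool.Base using (Bool; true; false; T; not; _∧_; if_then_else_)
open import Data.Bool.Properties using (T-≡; T-∧)
open import Data.Bool.ListAction using (any)
import Data.Fin.Base as Fin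
open import Data.Fin.Base using (Fin; zero; suc; toℕ; punchIn; _↑ˡ_; _↑ʳ_)
open import Data.Fin.Properties using (_≟_; 0≢1+n; suc-injective; toℕ<n; toℕ-↑ˡ; toℕ-↑ʳ; splitAt-↑ˡ; splitAt-↑ʳ; ≤∧≢⇒<; punchInᵢ≢i; punchIn-injective)
open import Data.Fin.Induction using (<-wellFounded)
open import Data.Fin.Permutation using (flip; Permutation′; _≈_; _⟨$⟩ʳ_; _⟨$⟩ˡ_; inverseˡ; inverseʳ; _∘ₚ_; transpose; remove; punchIn-permute)
import Data.Fin.Permutation.Components as PC
open import Data.List.Base using ([]; _∷_; tabulate; allFin; applyUpTo)
open import Data.List.Properties using (map-cong)
open import Data.List.Membership.Propositional using (lose)
open import Data.List.Membership.Propositional.Properties using (∈-allFin; ∈-upTo⁺)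
open import Data.List.Relation.Unary.Any.Properties using (any⁺)
open import Data.Product.Base using (_×_; _,_)
open import Data.Sum.Base using (_⊎_; inj₁)
open import Function.Base using (_∘_)
open import Function.Bundles using (Equivalence; Injection)
open import Function.Definitions using (Injective)
open import Function.Properties.Inverse using (↔⇒↣)
open import Induction.WellFounded using (Acc; acc)
open import Relation.Binary.PropositionalEquality
open import Relation.Nullary using (yes; no; ¬_; contradiction)
open import Relation.Nullary.Decidable using (isYes≗does; dec-true; dec-false; fromWitness)
open import Algebra.Bundles using (CommutativeSemiring)

countB-cong : ∀ {A : Set} {p q : A → Bool} → (∀ x → p x ≡ q x) → ∀ xs → countB p xs ≡ countB q xs
countB-cong p≗q xs = cong sum (map-cong (λ x → cong (λ b → if b then 1 else 0) (p≗q x)) xs)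

module _ {A : Set} (p : A → Bool) where

  countB-tabulate-≤ : ∀ {n} (f : Fin n → A) → countB p (tabulate f) ≤ n
  countB-tabulate-≤ {zero} f = z≤n
  countB-tabulate-≤ {suc n} f with p (f zero)
  ... | true = s≤s (countB-tabulate-≤ (f ∘ suc))
  ... | false = m≤n⇒m≤1+n (countB-tabulate-≤ (f ∘ suc))

  countB-tabulate-≡n : ∀ {n} (f : Fin n → A) → countB p (tabulate f) ≡ n → ∀ i → p (f i) ≡ true
  countB-tabulate-≡n {suc n} f count≡n with p (f zero) in pf₀
  countB-tabulate-≡n {suc n} f count≡n | true = λ where
    zero → pf₀
    (suc i) → countB-tabulate-≡n (f ∘ suc) (ℕ.suc-injective count≡n) i
  countB-tabulate-≡n {suc n} f count≡n | false =
    contradiction count≡n (<⇒≢ (s≤s (countB-tabulate-≤ (f ∘ suc))))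

  countB-tabulate-none : ∀ {n} (f : Fin n → A) → (∀ i → p (f i) ≡ false) → countB p (tabulate f) ≡ 0
  countB-tabulate-none {zero} f none = refl
  countB-tabulate-none {suc n} f none rewrite none zero = countB-tabulate-none (f ∘ suc) (none ∘ suc)

  countB-tabulate-+ : ∀ m {n} (f : Fin (m + n) → A) →
    countB p (tabulate f) ≡ countB p (tabulate (f ∘ (_↑ˡ n))) + countB p (tabulate (f ∘ (m ↑ʳ_)))
  countB-tabulate-+ zero f = refl
  countB-tabulate-+ (suc m) {n} f =
    trans (cong (head +_) (countB-tabulate-+ m (f ∘ suc)))
          (sym (+-assoc head (countB p (tabulate (f ∘ suc ∘ (_↑ˡ n)))) (countB p (tabulate (f ∘ suc ∘ (m ↑ʳ_))))))
    where head = if p (f zero) then 1 else 0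

eqB-refl : ∀ {N} (a : Fin N) → eqB a a ≡ true
eqB-refl a = trans (isYes≗does (a ≟ a)) (dec-true (a ≟ a) refl)

eqB-≢ : ∀ {N} {a b : Fin N} → a ≢ b → eqB a b ≡ false
eqB-≢ {a = a} {b} a≢b = trans (isYes≗does (a ≟ b)) (dec-false (a ≟ b) a≢b)

countB-eqB-tabulate : ∀ {N n} {f : Fin n → Fin N} → Injective _≡_ _≡_ f → ∀ i → countB (eqB (f i)) (tabulate f) ≡ 1
countB-eqB-tabulate {f = f} inj zero rewrite eqB-refl (f zero) =
  cong suc (countB-tabulate-none _ (f ∘ suc) (λ _ → eqB-≢ (0≢1+n ∘ inj)))
countB-eqB-tabulate {f = f} inj (suc i) rewrite eqB-≢ {a = f (suc i)} {f zero} (0≢1+n ∘ sym ∘ inj) =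
  countB-eqB-tabulate (suc-injective ∘ inj) i

any-false : ∀ {A : Set} {p : A → Bool} → (∀ x → p x ≡ false) → ∀ xs → any p xs ≡ false
any-false none [] = refl
any-false none (x ∷ xs) rewrite none x = any-false none xs

iter-suc : ∀ {N} (f : Fin N → Fin N) k i → iter f (suc k) i ≡ iter f k (f i)
iter-suc f zero i = refl
iter-suc f (suc k) i = cong f (iter-suc f k i)

iter-fixed : ∀ {N} {f : Fin N → Fin N} {i} → f i ≡ i → ∀ k → iter f k i ≡ i
iter-fixed fi≡i zero = refl
iter-fixed {f = f} fi≡i (suc k) = trans (cong f (iter-fixed fi≡i k)) fi≡i

T-reachB-iter : ∀ {N} (f : Fin N → Fin N) i {k} → k < suc N → T (reachB f i (iter f k i))
T-reachB-iter f i k<1+N = any⁺ _ (lose (∈-upTo⁺ k<1+N) (fromWitness refl))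

reachB-fixed : ∀ {N} {f : Fin N → Fin N} {i} → f i ≡ i → ∀ j → reachB f i j ≡ eqB i j
reachB-fixed {N} {f} {i} fi≡i j with eqB i j in eqB-ij
... | true = refl
... | false = any-false {p = λ k → eqB (iter f k i) j} (λ k → trans (cong (λ z → eqB z j) (iter-fixed fi≡i k)) eqB-ij) (applyUpTo suc N)

⟨$⟩ʳ-injective : ∀ {n} (π : Permutation′ n) → Injective _≡_ _≡_ (π ⟨$⟩ʳ_)
⟨$⟩ʳ-injective π = Injection.injective (↔⇒↣ π)

⟨$⟩ˡ-injective : ∀ {n} (π : Permutation′ n) → Injective _≡_ _≡_ (π ⟨$⟩ˡ_)
⟨$⟩ˡ-injective π = ⟨$⟩ʳ-injective (flip π)

injective-nonincreasing⇒id : ∀ {n} {g : Fin n → Fin n} → Injective _≡_ _≡_ g → (∀ x → g x Fin.≤ x) → ∀ x → g x ≡ x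
injective-nonincreasing⇒id {g = g} inj g≤id x = go x (<-wellFounded x)
  where
  go : ∀ x → Acc Fin._<_ x → g x ≡ x
  go x (acc rec) with g x ≟ x
  ... | yes gx≡x = gx≡x
  ... | no gx≢x = contradiction (inj (go (g x) (rec (≤∧≢⇒< (g≤id x) gx≢x)))) gx≢x

module VertexOrbits {n} (r l : Permutation′ n) where

  private
    D : Dimap
    D = dimap n r l

  -- vertices D unfolds to countB minimalInOrbit (allFin (n + n))
  minimalInOrbit : Fin (n + n) → Bool
  minimalInOrbit i = not (any (λ j → (toℕ j <ᵇ toℕ i) ∧ reachB (σ D) j i) (allFin (n + n)))

  σ-inEnd : ∀ e → σ D (e ↑ˡ n) ≡ n ↑ʳ (r ⟨$⟩ʳ e)
  σ-inEnd e rewrite splitAt-↑ˡ n e n = refl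

  σ-outEnd : ∀ f → σ D (n ↑ʳ f) ≡ (l ⟨$⟩ˡ f) ↑ˡ n
  σ-outEnd f rewrite splitAt-↑ʳ n n f = refl

  reached-not-minimal : ∀ {i j} k → k < suc (n + n) → iter (σ D) k j ≡ i → toℕ j < toℕ i → minimalInOrbit i ≡ false
  reached-not-minimal {j = j} k k<1+2n refl j<i =
    cong not (Equivalence.to T-≡ (any⁺ _ (lose (∈-allFin j) (Equivalence.from T-∧ (<⇒<ᵇ j<i , T-reachB-iter (σ D) j k<1+2n)))))

  2≤n+n : Fin n → 2 ≤ n + n
  2≤n+n e = ℕ.+-mono-≤ {1} {n} {1} {n} 1≤n 1≤n
    where 1≤n = ≤-trans (s≤s z≤n) (toℕ<n e)

  outEnd-not-minimal : ∀ f → minimalInOrbit (n ↑ʳ f) ≡ false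
  outEnd-not-minimal f = reached-not-minimal 1 (s≤s (≤-trans (s≤s z≤n) (2≤n+n f))) σ-first before
    where
    e = r ⟨$⟩ˡ f
    σ-first : σ D (e ↑ˡ n) ≡ n ↑ʳ f
    σ-first = trans (σ-inEnd e) (cong (n ↑ʳ_) (inverseʳ r))
    before : toℕ (e ↑ˡ n) < toℕ (n ↑ʳ f)
    before rewrite toℕ-↑ˡ e n | toℕ-↑ʳ n f = ≤-trans (toℕ<n e) (m≤m+n n (toℕ f))

  module _ (vertices≡n : vertices D ≡ n) where

    inEnd-minimal : ∀ e → minimalInOrbit (e ↑ˡ n) ≡ true
    inEnd-minimal = countB-tabulate-≡n minimalInOrbit (_↑ˡ n) inEnds≡n
      where
      open ≡-Reasoning
      #in = countB minimalInOrbit (tabulate (_↑ˡ n))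
      #out = countB minimalInOrbit (tabulate (n ↑ʳ_))
      inEnds≡n : #in ≡ n
      inEnds≡n = begin
        #in         ≡⟨ sym (ℕ.+-identityʳ #in) ⟩
        #in + 0     ≡⟨ cong (#in +_) (sym (countB-tabulate-none minimalInOrbit (n ↑ʳ_) outEnd-not-minimal)) ⟩
        #in + #out  ≡⟨ sym (countB-tabulate-+ minimalInOrbit n (λ i → i)) ⟩
        vertices D  ≡⟨ vertices≡n ⟩
        n           ∎

    vs-nonincreasing : ∀ e → vs D e Fin.≤ e
    vs-nonincreasing e = ≮⇒≥ λ e<vse → contradiction
      (trans (sym (inEnd-minimal (vs D e))) (reached-not-minimal 2 (s≤s (2≤n+n e)) σ² (before e<vse)))
      λ ()
      where
      σ² : iter (σ D) 2 (e ↑ˡ n) ≡ vs D e ↑ˡ n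
      σ² = trans (cong (σ D) (σ-inEnd e)) (σ-outEnd (r ⟨$⟩ʳ e))
      before : toℕ e < toℕ (vs D e) → toℕ (e ↑ˡ n) < toℕ (vs D e ↑ˡ n)
      before rewrite toℕ-↑ˡ e n | toℕ-↑ˡ (vs D e) n = λ lt → lt

    vs≡id : ∀ e → vs D e ≡ e
    vs≡id = injective-nonincreasing⇒id (⟨$⟩ʳ-injective r ∘ ⟨$⟩ˡ-injective l) vs-nonincreasing

    r≈l : r ≈ l
    r≈l e = trans (sym (inverseʳ l)) (cong (l ⟨$⟩ʳ_) (vs≡id e))

module _ {n} (i j : Fin n) where

  transpose-i : PC.transpose i j i ≡ j
  transpose-i rewrite dec-true (i ≟ i) refl = refl

  transpose-j : PC.transpose i j j ≡ i
  transpose-j with j ≟ i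
  ... | yes j≡i = j≡i
  ... | no _ rewrite dec-true (j ≟ j) refl = refl

  transpose-≢ : ∀ {k} → k ≢ i → k ≢ j → PC.transpose i j k ≡ k
  transpose-≢ {k} k≢i k≢j rewrite dec-false (k ≟ i) k≢i | dec-false (k ≟ j) k≢j = refl

transpose-ii : ∀ {n} (i k : Fin n) → PC.transpose i i k ≡ k
transpose-ii i k with k ≟ i
... | yes k≡i = sym k≡i
... | no k≢i rewrite dec-false (k ≟ i) k≢i = refl

opaque
  unfolding skip

  punchIn-skip : ∀ {k d} {π : Permutation′ (suc k)} → π ⟨$⟩ʳ d ≡ d →
                 ∀ j → punchIn d (skip d π ⟨$⟩ʳ j) ≡ π ⟨$⟩ʳ punchIn d j
  punchIn-skip {k} {d} {π} πd≡d j = begin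
    punchIn d (remove d ρ ⟨$⟩ʳ j)        ≡⟨ cong (λ z → punchIn z (remove d ρ ⟨$⟩ʳ j)) (sym ρd≡d) ⟩
    punchIn (ρ ⟨$⟩ʳ d) (remove d ρ ⟨$⟩ʳ j) ≡⟨ sym (punchIn-permute ρ d j) ⟩
    ρ ⟨$⟩ʳ punchIn d j                    ≡⟨ cong (π ⟨$⟩ʳ_) (trans (cong (λ z → PC.transpose z d (punchIn d j)) π⁻¹d≡d) (transpose-ii d _)) ⟩
    π ⟨$⟩ʳ punchIn d j                    ∎
    where
    open ≡-Reasoning
    ρ : Permutation′ (suc k)
    ρ = transpose (π ⟨$⟩ˡ d) d ∘ₚ π
    π⁻¹d≡d : π ⟨$⟩ˡ d ≡ d
    π⁻¹d≡d = trans (cong (π ⟨$⟩ˡ_) (sym πd≡d)) (inverseˡ π)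
    ρd≡d : ρ ⟨$⟩ʳ d ≡ d
    ρd≡d = trans (cong (π ⟨$⟩ʳ_) (trans (cong (λ z → PC.transpose z d d) π⁻¹d≡d) (transpose-ii d d))) πd≡d

SingleOrbit : ∀ {N} → (Fin N → Fin N) → Set
SingleOrbit f = ∀ a b → SameOrbit f a b

sameOrbit-step : ∀ {N} {g : Fin N → Fin N} {a a′ b} → g a ≡ a′ → SameOrbit g a′ b → SameOrbit g a b
sameOrbit-step {g = g} {a} ga≡a′ (k , gᵏa′≡b) = suc k , trans (iter-suc g k a) (trans (cong (iter g k) ga≡a′) gᵏa′≡b)

singleOrbit⇒no-fixed-point : ∀ {k} {f : Fin (suc (suc k)) → Fin (suc (suc k))} → SingleOrbit f → ∀ e → f e ≢ e
singleOrbit⇒no-fixed-point single e fe≡e with single e (punchIn e zero)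
... | k , fᵏe≡e′ = punchInᵢ≢i e zero (trans (sym fᵏe≡e′) (iter-fixed fe≡e k))

module Shortcut {N} {f : Fin N → Fin N} (f-injective : Injective _≡_ _≡_ f) (e : Fin N) where

  -- f with the point f e bypassed: e ↦ f (f e), and f e becomes a fixed point
  shortcut : Fin N → Fin N
  shortcut x = f (PC.transpose e (f e) x)

  sameOrbit-shortcut : ∀ k {a b} → a ≢ f e → b ≢ f e → iter f k a ≡ b → SameOrbit shortcut a b
  sameOrbit-shortcut zero _ _ a≡b = zero , a≡b
  sameOrbit-shortcut (suc k) {a} a≢fe b≢fe fᵏ⁺¹a≡b with a ≟ e
  sameOrbit-shortcut (suc zero) a≢fe b≢fe fe≡b | yes refl = contradiction (sym fe≡b) b≢fe
  sameOrbit-shortcut (suc (suc k)) a≢fe b≢fe fᵏ⁺²e≡b | yes refl =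
    sameOrbit-step (cong f (transpose-i e (f e)))
      (sameOrbit-shortcut k (a≢fe ∘ sym ∘ f-injective) b≢fe
        (trans (sym (trans (iter-suc f (suc k) e) (iter-suc f k (f e)))) fᵏ⁺²e≡b))
  ... | no a≢e =
    sameOrbit-step (cong f (transpose-≢ e (f e) a≢e a≢fe))
      (sameOrbit-shortcut k (a≢e ∘ f-injective) b≢fe (trans (sym (iter-suc f k a)) fᵏ⁺¹a≡b))

module _ {n} (r l : Permutation′ n) (r≈l : r ≈ l) where

  r≈l⇒vs≡id : ∀ e → vs (dimap n r l) e ≡ e
  r≈l⇒vs≡id e = trans (cong (l ⟨$⟩ˡ_) (r≈l e)) (inverseˡ l)

  r≈l⇒oneLoop : ∀ e → OneLoop (dimap n r l) e
  r≈l⇒oneLoop e = cong (2 *_) (begin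
    countB (reachB (vs (dimap n r l)) e) (allFin n) ≡⟨ countB-cong (reachB-fixed (r≈l⇒vs≡id e)) (allFin n) ⟩
    countB (eqB e) (allFin n)                        ≡⟨ countB-eqB-tabulate (λ i≡j → i≡j) e ⟩
    1                                                ∎)
    where open ≡-Reasoning

module NontrivialCycle {k} (r l : Permutation′ (suc (suc k))) (r≈l : r ≈ l)
                 (single : SingleOrbit (r ⟨$⟩ʳ_)) where

  private
    D : Dimap
    D = dimap (suc (suc k)) r l

  no-fixed-point : ∀ e → r ⟨$⟩ʳ e ≢ e
  no-fixed-point = singleOrbit⇒no-fixed-point single

  ¬ultraloop : ∀ e → ¬ Ultraloop D e
  ¬ultraloop e (_ , _ , re≡e) = no-fixed-point e re≡e

  properOneLoop : ∀ e → ProperOneLoop D e ⊎ ProperOmegaSemiloop D e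
  properOneLoop e = inj₁ (r≈l⇒oneLoop r l r≈l e , ¬ultraloop e)

  redω²≡merge : ∀ e → redω² r l e ≡ merge r l e (r ⟨$⟩ʳ e)
  redω²≡merge e rewrite eqB-≢ (no-fixed-point e ∘ trans (r≈l e)) | eqB-≢ (no-fixed-point e) = refl

  module Contraction (e : Fin (suc (suc k))) where

    s : Fin (suc (suc k))
    s = r ⟨$⟩ʳ e

    r′ l′ : Permutation′ (suc k)
    r′ = skip s (transpose e s ∘ₚ r)
    l′ = skip s (transpose e s ∘ₚ l)

    open Shortcut (⟨$⟩ʳ-injective r) e

    r′≈l′ : r′ ≈ l′
    r′≈l′ j = punchIn-injective s _ _ (begin
      punchIn s (r′ ⟨$⟩ʳ j)    ≡⟨ punchIn-skip (cong (r ⟨$⟩ʳ_) (transpose-j e s)) j ⟩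
      shortcut (punchIn s j)   ≡⟨ r≈l _ ⟩
      l ⟨$⟩ʳ PC.transpose e s (punchIn s j) ≡⟨ sym (punchIn-skip (trans (cong (l ⟨$⟩ʳ_) (transpose-j e s)) (sym (r≈l e))) j) ⟩
      punchIn s (l′ ⟨$⟩ʳ j)    ∎)
      where open ≡-Reasoning

    punchIn-iter-r′ : ∀ j a → punchIn s (iter (r′ ⟨$⟩ʳ_) j a) ≡ iter shortcut j (punchIn s a)
    punchIn-iter-r′ zero a = refl
    punchIn-iter-r′ (suc j) a =
      trans (punchIn-skip (cong (r ⟨$⟩ʳ_) (transpose-j e s)) _) (cong shortcut (punchIn-iter-r′ j a))

    single′ : SingleOrbit (r′ ⟨$⟩ʳ_)
    single′ a b with single (punchIn s a) (punchIn s b)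
    ... | j , rʲa≡b with sameOrbit-shortcut j (punchInᵢ≢i s a) (punchInᵢ≢i s b) rʲa≡b
    ... | j′ , h = j′ , punchIn-injective s _ _ (trans (punchIn-iter-r′ j′ a) h)

Fin1-≡ : (a b : Fin 1) → a ≡ b
Fin1-≡ zero zero = refl

module _ {c ℓ} (R : CommutativeSemiring c ℓ) (x y : CommutativeSemiring.Carrier R) where
  open CommutativeSemiring R using (*-cong) renaming (_≈_ to _≈ᴿ_; refl to ≈ᴿ-refl)

  ultraloop-size1 : ∀ (r l : Permutation′ 1) → r ≈ l → ∀ e → Ultraloop (dimap 1 r l) e
  ultraloop-size1 r l r≈l e = r≈l⇒oneLoop r l r≈l e , Fin1-≡ (l ⟨$⟩ʳ e) e , Fin1-≡ (r ⟨$⟩ʳ e) e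

  Tc-cycle : ∀ k (r l : Permutation′ (suc k)) → r ≈ l → SingleOrbit (r ⟨$⟩ʳ_) →
             Tc R x y (dimap (suc k) r l) (pow R x k)
  Tc-cycle zero r l r≈l _ = tc-ultra zero (ultraloop-size1 r l r≈l zero) tc-empty
  Tc-cycle (suc k) r l r≈l single =
    tc-x zero (¬ultraloop zero) (properOneLoop zero)
      (subst (λ D → Tc R x y D (pow R x k)) (sym (redω²≡merge zero)) (Tc-cycle k r′ l′ r′≈l′ single′))
    where
    open NontrivialCycle r l r≈l single
    open Contraction zero

  Tc-cycle-unique : ∀ k (r l : Permutation′ (suc k)) → r ≈ l → SingleOrbit (r ⟨$⟩ʳ_) →
                    ∀ {t} → Tc R x y (dimap (suc k) r l) t → t ≈ᴿ pow R x k
  Tc-cycle-unique zero r l r≈l _ (tc-ultra e _ tc-empty) = ≈ᴿ-refl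
  Tc-cycle-unique zero r l r≈l _ (tc-x e ¬u _ _) = contradiction (ultraloop-size1 r l r≈l e) ¬u
  Tc-cycle-unique zero r l r≈l _ (tc-y e ¬u _ _ _) = contradiction (ultraloop-size1 r l r≈l e) ¬u
  Tc-cycle-unique zero r l r≈l _ (tc-ω e ¬u _ _ _ _) = contradiction (ultraloop-size1 r l r≈l e) ¬u
  Tc-cycle-unique zero r l r≈l _ (tc-sum e ¬u _ _ _ _ _) = contradiction (ultraloop-size1 r l r≈l e) ¬u
  Tc-cycle-unique (suc k) r l r≈l single (tc-ultra e u _) = contradiction u (NontrivialCycle.¬ultraloop r l r≈l single e)
  Tc-cycle-unique (suc k) r l r≈l single (tc-x e _ _ Tc-redω²) =
    *-cong ≈ᴿ-refl (Tc-cycle-unique k r′ l′ r′≈l′ single′ (subst (λ D → Tc R x y D _) (redω²≡merge e) Tc-redω²))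
    where
    open NontrivialCycle r l r≈l single
    open Contraction e
  Tc-cycle-unique (suc k) r l r≈l single (tc-y e _ ¬x _ _) = contradiction (NontrivialCycle.properOneLoop r l r≈l single e) ¬x
  Tc-cycle-unique (suc k) r l r≈l single (tc-ω e _ ¬x _ _ _) = contradiction (NontrivialCycle.properOneLoop r l r≈l single e) ¬x
  Tc-cycle-unique (suc k) r l r≈l single (tc-sum e _ ¬x _ _ _ _) = contradiction (NontrivialCycle.properOneLoop r l r≈l single e) ¬x

lemma7p11 : ∀ {c ℓ} (R : CommutativeSemiring c ℓ) (x y : CommutativeSemiring.Carrier R)
              (m : ℕ) (D : Dimap) → 1 ≤ m → Plane D → CCycleBlock D m →
              Tc R x y D (pow R x (m ∸ 1))
              × (∀ t → Tc R x y D t → CommutativeSemiring._≈_ R t (pow R x (m ∸ 1)))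
lemma7p11 R x y (suc k) (dimap n r l) (s≤s z≤n) _ (refl , single , vertices≡n) =
  Tc-cycle R x y k r l r≈l single , λ _ → Tc-cycle-unique R x y k r l r≈l single
  where
  r≈l = VertexOrbits.r≈l r l vertices≡n
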